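{- Let $G$ be a labeled complete bipartite graph with partite sets $V_1,V_2$, let $0<\gamma<\alpha<1/2$, let $x$ be a fractional clustering of $G$, and run Algorithm B (described in the context). Suppose that at some iteration, with current vertex set $S$ and pivot $u\in V_1\cap S$, the cluster $C=\{u\}\cup T$ is output because $\sum_{w\in V_2\cap T}x_{uw}<\alpha|V_2\cap T|/2$. Then for every $z\in (V_1\cap S)\setminus C$, the number of $+$ edges from $z$ to $C$ is at most $\max\{1/(1-2\alpha),\,2/\alpha\}$ times $\sum_{w\in C\cap N^+(z)}x_{wz}+\sum_{w\in C\cap N^-(z)}(1-x_{wz})$.
   Context: A labeled complete bipartite graph has each edge (pair with one endpoint in each of $V_1,V_2$) labeled $+$ or $-$; $N^+(v)$, $N^-(v)$ are the $+$ and $-$ neighborhoods. A fractional clustering is a vector $x$ indexed by all unordered pairs of distinct vertices with $x_{uv}\in[0,1]$ and $x_{vz}\le x_{vw}+x_{wz}$ for all distinct $v,w,z$; $x_{uu}=0$. Algorithm B: Set $S=V(G)$. While $V_1\cap S\neq\emptyset$: for each $u\in V_1\cap S$ let $T_u=\{w\in S\setminus\{u\}: x_{uw}\le\alpha\}$ and $T^*_u=\{w\in V_2\cap S: x_{uw}\le\gamma\}$; choose a pivot $u\in V_1\cap S$ maximizing $|T^*_u|$; let $T=T_u$. If $\sum_{w\in V_2\cap T}x_{uw}\ge\alpha|V_2\cap T|/2$, output $\{u\}$ and set $S=S\setminus\{u\}$; otherwise output $\{u\}\cup T$ and set $S=S\setminus(\{u\}\cup T)$. Finally output each remaining vertex of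 $V_2\cap S$ as a singleton.
   Formalization: The parameters α and γ and the values of the fractional clustering x are rational. -}

module Defs where

open import Data.Bool using (Bool; true; false; _∧_; not; if_then_else_)
open import Data.Nat using (ℕ) renaming (_≤_ to _≤ℕ_)
open import Data.Integer using (+_)
open import Data.Fin using (Fin; _≟_)
open import Data.List using (List; length; map; filterᵇ; foldr)
open import Data.List using () renaming (allFin to allFinL)
open import Data.Rational using (ℚ; 0ℚ; 1ℚ; _+_; _-_; _*_; _/_; _≤_; _<_; _≤ᵇ_; 1/_; _⊔_; ≢-nonZero)
import Data.Rational.Properties as ℚP
open import Data.Product using (_×_)
open import Relation.Nullary using (yes; no; ¬_)
open import Relation.Nullary.Decidable using (⌊_⌋)
open import Relation.Binary.PropositionalEquality using (_≡_; _≢_)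

VSet : ℕ → Set
VSet n = Fin n → Bool

vertices : (n : ℕ) → List (Fin n)
vertices n = allFinL n

card : {n : ℕ} → VSet n → ℕ
card {n} A = length (filterᵇ A (vertices n))

sumOver : {n : ℕ} → VSet n → (Fin n → ℚ) → ℚ
sumOver {n} A f = foldr _+_ 0ℚ (map f (filterᵇ A (vertices n)))

ℕtoℚ : ℕ → ℚ
ℕtoℚ k = (+ k) / 1

-- total reciprocal (1/p for p ≠ 0, junk value 0 at p = 0; only used at p ≠ 0)
recip : ℚ → ℚ
recip p with p ℚP.≟ 0ℚ
... | yes _ = 0ℚ
... | no p≢0 = 1/_ p {{≢-nonZero p≢0}}

eqᵇ : {n : ℕ} → Fin n → Fin n → Bool
eqᵇ u w = ⌊ u ≟ w ⌋

-- A labeled complete bipartite graph on vertex set Fin n.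
-- side v = true means v ∈ V₁, false means v ∈ V₂.
-- plus u w = true means the edge uw is labeled +, false means −
-- (only meaningful when u, w lie on different sides).
record LCBGraph (n : ℕ) : Set where
  field
    side     : Fin n → Bool
    plus     : Fin n → Fin n → Bool
    plus-sym : ∀ u w → plus u w ≡ plus w u

module _ {n : ℕ} (G : LCBGraph n) where
  open LCBGraph G

  V₁ : VSet n
  V₁ v = side v

  V₂ : VSet n
  V₂ v = not (side v)

  cross : Fin n → Fin n → Bool
  cross u w = not ⌊ Data.Bool._≟_ (side u) (side w) ⌋

  N⁺ : Fin n → VSet n
  N⁺ z w = cross z w ∧ plus z w

  N⁻ : Fin n → VSet n
  N⁻ z w = cross z w ∧ not (plus z w)

-- Fractional clustering: x indexed by pairs, represented as a symmetric
-- function with zero diagonal.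
record FracClustering (n : ℕ) (x : Fin n → Fin n → ℚ) : Set where
  field
    diag  : ∀ u → x u u ≡ 0ℚ
    sym   : ∀ u w → x u w ≡ x w u
    lower : ∀ u w → 0ℚ ≤ x u w
    upper : ∀ u w → x u w ≤ 1ℚ
    tri   : ∀ v w z → v ≢ w → w ≢ z → v ≢ z → x v z ≤ x v w + x w z

module AlgB {n : ℕ} (G : LCBGraph n) (x : Fin n → Fin n → ℚ) (α γ : ℚ) where

  _∩_ : VSet n → VSet n → VSet n
  (A ∩ B) w = A w ∧ B w

  _∖_ : VSet n → VSet n → VSet n
  (A ∖ B) w = A w ∧ not (B w)

  single : Fin n → VSet n
  single u w = eqᵇ u w

  T : VSet n → Fin n → VSet n
  T S u w = S w ∧ not (eqᵇ u w) ∧ (x u w ≤ᵇ α)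

  T* : VSet n → Fin n → VSet n
  T* S u w = V₂ G w ∧ S w ∧ (x u w ≤ᵇ γ)

  C : VSet n → Fin n → VSet n
  C S u w = eqᵇ u w ∨' T S u w
    where
      _∨'_ : Bool → Bool → Bool
      true ∨' _ = true
      false ∨' b = b

  sumV₂T : VSet n → Fin n → ℚ
  sumV₂T S u = sumOver (V₂ G ∩ T S u) (x u)

  threshold : VSet n → Fin n → ℚ
  threshold S u = α * ℕtoℚ (card (V₂ G ∩ T S u)) * ((+ 1) / 2)


  -- u is a legal pivot at current set S (any tie-breaking allowed)
  record Pivot (S : VSet n) (u : Fin n) : Set where
    field
      inV₁ : V₁ G u ≡ true
      inS  : S u ≡ true
      max  : ∀ v → V₁ G v ≡ true → S v ≡ true → card (T* S v) ≤ℕ card (T* S u)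

  data Step (S : VSet n) : VSet n → Set where
    step-single  : ∀ u → Pivot S u → threshold S u ≤ sumV₂T S u →
                   Step S (S ∖ single u)
    step-cluster : ∀ u → Pivot S u → sumV₂T S u < threshold S u →
                   Step S (S ∖ C S u)

  data Reachable : VSet n → Set where
    start : Reachable (λ _ → true)
    next  : ∀ {S S'} → Reachable S → Step S S' → Reachable S'

{-# OPTIONS --safe #-}
module Submission where

-- Write B = V₂ ∩ T for the vertices w with x_uw ≤ α; z splits B into P = C ∩ N⁺(z)
-- and Q = C ∩ N⁻(z), and z ∉ C means x_uz > α.  Let cost = Σ_P x_wz + Σ_Q (1 - x_wz).
-- If x_uz ≤ 1 - α/2, the triangle inequality gives x_wz + x_uw ≥ α on P and
-- (1 - x_wz) + x_uw ≥ α/2 on Q; summing over B and using Σ_B x_uw < α|B|/2 leaves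
-- (α/2)|P| ≤ cost.  If x_uz > 1 - α/2, then x_wz ≥ x_uz - x_uw > 1 - 2α on P, so
-- (1 - 2α)|P| ≤ cost.

open import Defs
open import Data.Nat using (ℕ; suc)
open import Data.Bool using (Bool; true; false; not; _∧_; if_then_else_)
open import Data.Bool.Properties using (∧-zeroʳ; ∧-conicalʳ; T-≡)
import Data.Bool as Bool
open import Data.Integer using (+_)
import Data.Integer as ℤ
import Data.Integer.Properties as ℤP
import Data.Nat.Coprimality as Coprime
open import Data.Fin using (Fin; _≟_)
open import Data.List using (List; []; _∷_; foldr; map; filterᵇ; length)
open import Data.Rational
  using (ℚ; mkℚ; 0ℚ; 1ℚ; _+_; -_; _-_; _*_; _/_; _≤_; _<_; _⊔_; ≢-nonZero; positive; nonNegative)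
import Data.Rational.Properties as ℚP
open ℚP using (≤-refl; <⇒≤; +-mono-≤; +-monoˡ-≤; +-monoʳ-≤; +-identityˡ; +-identityʳ)
open import Function using (_∘_)
open import Function.Bundles using (module Equivalence)
open import Level using (0ℓ)
open import Relation.Binary.PropositionalEquality
  using (_≡_; _≢_; refl; sym; trans; cong; cong₂; subst; subst₂)
open import Relation.Nullary using (yes; no; contradiction)
open import Relation.Nullary.Decidable.Core using (dec⇒maybe)
open import Tactic.RingSolver using (solve-∀)
open import Tactic.RingSolver.Core.AlmostCommutativeRing using (AlmostCommutativeRing; fromCommutativeRing)

ℚ-ring : AlmostCommutativeRing 0ℓ 0ℓ
ℚ-ring = fromCommutativeRing ℚP.+-*-commutativeRing (λ p → dec⇒maybe (0ℚ ℚP.≟ p))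

½ : ℚ
½ = (+ 1) / 2

p≤q⇒0≤q-p : ∀ {p q} → p ≤ q → 0ℚ ≤ q - p
p≤q⇒0≤q-p {p} {q} p≤q = subst (_≤ q - p) (ℚP.+-inverseʳ p) (+-monoˡ-≤ (- p) p≤q)

p<q⇒0<q-p : ∀ {p q} → p < q → 0ℚ < q - p
p<q⇒0<q-p {p} {q} p<q = subst (_< q - p) (ℚP.+-inverseʳ p) (ℚP.+-monoˡ-< (- p) p<q)

p≤q⇒r-q≤r-p : ∀ r {p q} → p ≤ q → r - q ≤ r - p
p≤q⇒r-q≤r-p r p≤q = +-monoʳ-≤ r (ℚP.neg-antimono-≤ p≤q)

recip-inverseʳ : ∀ {p} → 0ℚ < p → p * recip p ≡ 1ℚ
recip-inverseʳ {p} 0<p with p ℚP.≟ 0ℚ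
... | yes p≡0 = contradiction (sym p≡0) (ℚP.<⇒≢ 0<p)
... | no p≢0 = ℚP.*-inverseʳ p {{≢-nonZero p≢0}}

recip-nonNeg : ∀ {p} → 0ℚ < p → 0ℚ ≤ recip p
recip-nonNeg {p} 0<p with p ℚP.≟ 0ℚ
... | yes _ = ≤-refl
... | no p≢0 = <⇒≤ (ℚP.positive⁻¹ _ {{ℚP.1/pos⇒pos p {{positive 0<p}}}})

≤-by-inverse : ∀ a {c p q} → a * c ≡ 1ℚ → 0ℚ ≤ c → a * p ≤ q → p ≤ c * q
≤-by-inverse a {c} {p} {q} ac≡1 0≤c ap≤q = begin
  p             ≡⟨ sym (ℚP.*-identityˡ p) ⟩
  1ℚ * p        ≡⟨ cong (_* p) (sym ac≡1) ⟩
  a * c * p     ≡⟨ regroup a c p ⟩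
  c * (a * p)   ≤⟨ ℚP.*-monoˡ-≤-nonNeg c {{nonNegative 0≤c}} ap≤q ⟩
  c * q         ∎
  where
  open ℚP.≤-Reasoning
  regroup : ∀ a c p → a * c * p ≡ c * (a * p)
  regroup = solve-∀ ℚ-ring

ℕtoℚ≡mkℚ : ∀ k → ℕtoℚ k ≡ mkℚ (+ k) 0 (Coprime.sym (Coprime.1-coprimeTo k))
ℕtoℚ≡mkℚ k = ℚP.normalize-coprime (Coprime.sym (Coprime.1-coprimeTo k))

ℕtoℚ-suc : ∀ k → ℕtoℚ (suc k) ≡ 1ℚ + ℕtoℚ k
ℕtoℚ-suc k rewrite ℕtoℚ≡mkℚ k =
  cong (_/ 1) (cong (ℤ._+_ (+ 1)) (sym (ℤP.*-identityʳ (+ k))))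

infixr 8 [_]·_

[_]·_ : Bool → ℚ → ℚ
[ b ]· q = if b then q else 0ℚ

∑ : {A : Set} → (A → ℚ) → List A → ℚ
∑ f xs = foldr _+_ 0ℚ (map f xs)

module _ {A : Set} where

  ∑-filterᵇ : ∀ (P : A → Bool) f xs → ∑ f (filterᵇ P xs) ≡ ∑ (λ a → [ P a ]· f a) xs
  ∑-filterᵇ P f [] = refl
  ∑-filterᵇ P f (a ∷ xs) with P a
  ... | true  = cong (_+_ (f a)) (∑-filterᵇ P f xs)
  ... | false = trans (∑-filterᵇ P f xs) (sym (+-identityˡ _))

  ℕtoℚ-length : ∀ (xs : List A) → ℕtoℚ (length xs) ≡ ∑ (λ _ → 1ℚ) xs
  ℕtoℚ-length [] = refl
  ℕtoℚ-length (a ∷ xs) = trans (ℕtoℚ-suc (length xs)) (cong (_+_ 1ℚ) (ℕtoℚ-length xs))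

  ∑-+ : ∀ (f g : A → ℚ) xs → ∑ (λ a → f a + g a) xs ≡ ∑ f xs + ∑ g xs
  ∑-+ f g [] = refl
  ∑-+ f g (a ∷ xs) =
    trans (cong (_+_ (f a + g a)) (∑-+ f g xs)) (interchange (f a) (g a) (∑ f xs) (∑ g xs))
    where
    interchange : ∀ p q r s → (p + q) + (r + s) ≡ (p + r) + (q + s)
    interchange = solve-∀ ℚ-ring

  ∑-*ˡ : ∀ c (f : A → ℚ) xs → ∑ (λ a → c * f a) xs ≡ c * ∑ f xs
  ∑-*ˡ c f [] = sym (ℚP.*-zeroʳ c)
  ∑-*ˡ c f (a ∷ xs) =
    trans (cong (_+_ (c * f a)) (∑-*ˡ c f xs)) (sym (ℚP.*-distribˡ-+ c (f a) (∑ f xs)))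

  ∑-nonNeg : ∀ {f : A → ℚ} → (∀ a → 0ℚ ≤ f a) → ∀ xs → 0ℚ ≤ ∑ f xs
  ∑-nonNeg 0≤f [] = ≤-refl
  ∑-nonNeg 0≤f (a ∷ xs) = +-mono-≤ (0≤f a) (∑-nonNeg 0≤f xs)

  ∑-mono-≤ : ∀ {f g : A → ℚ} → (∀ a → f a ≤ g a) → ∀ xs → ∑ f xs ≤ ∑ g xs
  ∑-mono-≤ f≤g [] = ≤-refl
  ∑-mono-≤ f≤g (a ∷ xs) = +-mono-≤ (f≤g a) (∑-mono-≤ f≤g xs)

module _ {n : ℕ} where

  sumOver≡∑ : ∀ (A : VSet n) f → sumOver A f ≡ ∑ (λ w → [ A w ]· f w) (vertices n)
  sumOver≡∑ A f = ∑-filterᵇ A f (vertices n)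

  card≡∑ : ∀ (A : VSet n) → ℕtoℚ (card A) ≡ ∑ (λ w → [ A w ]· 1ℚ) (vertices n)
  card≡∑ A = trans (ℕtoℚ-length (filterᵇ A (vertices n))) (sumOver≡∑ A (λ _ → 1ℚ))

module FracClusteringProperties {n : ℕ} {x : Fin n → Fin n → ℚ} (fc : FracClustering n x) where
  open FracClustering fc using (diag; lower; tri)

  triangle : ∀ v w z → x v z ≤ x v w + x w z
  triangle v w z with v ≟ w | w ≟ z | v ≟ z
  ... | yes refl | _ | _ = ℚP.≤-reflexive (sym (trans (cong (_+ x v z) (diag v)) (+-identityˡ (x v z))))
  ... | no _ | yes refl | _ =
    ℚP.≤-reflexive (sym (trans (cong (_+_ (x v w)) (diag w)) (+-identityʳ (x v w))))
  ... | no _ | no _ | yes refl = subst (_≤ x v w + x w v) (sym (diag v)) (+-mono-≤ (lower v w) (lower w v))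
  ... | no v≢w | no w≢z | no v≢z = tri v w z v≢w w≢z v≢z

[]·-nonNeg : ∀ b {q} → 0ℚ ≤ q → 0ℚ ≤ [ b ]· q
[]·-nonNeg true  0≤q = 0≤q
[]·-nonNeg false _   = ≤-refl

data DisjointUnion : Bool → Bool → Bool → Set where
  left    : DisjointUnion true true false
  right   : DisjointUnion true false true
  neither : DisjointUnion false false false

module Charging {n : ℕ} {x : Fin n → Fin n → ℚ} (fc : FracClustering n x)
  {α : ℚ} (0<α : 0ℚ < α) (α<½ : α < ½) {u z : Fin n} (α<xuz : α < x u z)
  (B P Q : VSet n) (B≡P⊎Q : ∀ w → DisjointUnion (B w) (P w) (Q w))
  (B⇒x≤α : ∀ w → B w ≡ true → x u w ≤ α) where

  open FracClustering fc using (lower; upper) renaming (sym to x-sym)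
  open FracClusteringProperties fc using (triangle)
  open ℚP.≤-Reasoning

  h k : ℚ
  h = α * ½
  k = 1ℚ - (+ 2) / 1 * α

  0≤h : 0ℚ ≤ h
  0≤h = ℚP.*-monoʳ-≤-nonNeg ½ (<⇒≤ 0<α)

  cost : Fin n → ℚ
  cost w = [ P w ]· x w z + [ Q w ]· (1ℚ - x w z)

  cost-nonNeg : ∀ w → 0ℚ ≤ cost w
  cost-nonNeg w = +-mono-≤ ([]·-nonNeg (P w) (lower w z)) ([]·-nonNeg (Q w) (p≤q⇒0≤q-p (upper w z)))

  near-pointwise : x u z ≤ 1ℚ - h →
                   ∀ w → h * [ P w ]· 1ℚ + h * [ B w ]· 1ℚ ≤ cost w + [ B w ]· x u w
  near-pointwise near w = go (B≡P⊎Q w)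
    where
    go : ∀ {b p q} → DisjointUnion b p q →
         h * [ p ]· 1ℚ + h * [ b ]· 1ℚ ≤ ([ p ]· x w z + [ q ]· (1ℚ - x w z)) + [ b ]· x u w
    go left = begin
      h * 1ℚ + h * 1ℚ       ≡⟨ halves α ⟩
      α                     <⟨ α<xuz ⟩
      x u z                 ≤⟨ triangle u w z ⟩
      x u w + x w z         ≡⟨ swap (x u w) (x w z) ⟩
      (x w z + 0ℚ) + x u w  ∎
      where
      halves : ∀ a → a * ½ * 1ℚ + a * ½ * 1ℚ ≡ a
      halves = solve-∀ ℚ-ring
      swap : ∀ a b → a + b ≡ (b + 0ℚ) + a
      swap = solve-∀ ℚ-ring
    go right = begin
      h * 0ℚ + h * 1ℚ                ≡⟨ one-half α ⟩
      1ℚ - (1ℚ - h)                  ≤⟨ p≤q⇒r-q≤r-p 1ℚ near ⟩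
      1ℚ - x u z                     ≡⟨ shift (x u w) (x u z) ⟩
      (1ℚ - (x u w + x u z)) + x u w ≤⟨ +-monoˡ-≤ (x u w) (p≤q⇒r-q≤r-p 1ℚ xwz≤xuw+xuz) ⟩
      (1ℚ - x w z) + x u w           ≡⟨ cong (_+ x u w) (sym (+-identityˡ (1ℚ - x w z))) ⟩
      (0ℚ + (1ℚ - x w z)) + x u w    ∎
      where
      xwz≤xuw+xuz : x w z ≤ x u w + x u z
      xwz≤xuw+xuz = subst (λ d → x w z ≤ d + x u z) (x-sym w u) (triangle w u z)
      one-half : ∀ a → a * ½ * 0ℚ + a * ½ * 1ℚ ≡ 1ℚ - (1ℚ - a * ½)
      one-half = solve-∀ ℚ-ring
      shift : ∀ a t → 1ℚ - t ≡ (1ℚ - (a + t)) + a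
      shift = solve-∀ ℚ-ring
    go neither = ℚP.≤-reflexive (zeros α)
      where
      zeros : ∀ a → a * ½ * 0ℚ + a * ½ * 0ℚ ≡ (0ℚ + 0ℚ) + 0ℚ
      zeros = solve-∀ ℚ-ring

  far-pointwise : 1ℚ - h < x u z → ∀ w → k * [ P w ]· 1ℚ ≤ cost w
  far-pointwise far w = go (B≡P⊎Q w) (B⇒x≤α w)
    where
    go : ∀ {b p q} → DisjointUnion b p q → (b ≡ true → x u w ≤ α) →
         k * [ p ]· 1ℚ ≤ [ p ]· x w z + [ q ]· (1ℚ - x w z)
    go left close = begin
      k * 1ℚ                    ≡⟨ sym (+-identityʳ (k * 1ℚ)) ⟩
      k * 1ℚ + 0ℚ               ≤⟨ +-monoʳ-≤ (k * 1ℚ) 0≤h ⟩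
      k * 1ℚ + h                ≡⟨ margin α ⟩
      (1ℚ - h) - α              <⟨ ℚP.+-monoˡ-< (- α) far ⟩
      x u z - α                 ≤⟨ p≤q⇒r-q≤r-p (x u z) (close refl) ⟩
      x u z - x u w             ≤⟨ +-monoˡ-≤ (- x u w) (triangle u w z) ⟩
      (x u w + x w z) - x u w   ≡⟨ cancel (x u w) (x w z) ⟩
      x w z + 0ℚ                ∎
      where
      margin : ∀ a → (1ℚ - (+ 2) / 1 * a) * 1ℚ + a * ½ ≡ (1ℚ - a * ½) - a
      margin = solve-∀ ℚ-ring
      cancel : ∀ a b → (a + b) - a ≡ b + 0ℚ
      cancel = solve-∀ ℚ-ring
    go right _ = begin
      k * 0ℚ              ≡⟨ ℚP.*-zeroʳ k ⟩
      0ℚ                  ≤⟨ p≤q⇒0≤q-p (upper w z) ⟩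
      1ℚ - x w z          ≡⟨ sym (+-identityˡ (1ℚ - x w z)) ⟩
      0ℚ + (1ℚ - x w z)   ∎
    go neither _ = ℚP.≤-reflexive (ℚP.*-zeroʳ k)

  vs : List (Fin n)
  vs = vertices n

  #P #B ΣB total : ℚ
  #P    = ∑ (λ w → [ P w ]· 1ℚ) vs
  #B    = ∑ (λ w → [ B w ]· 1ℚ) vs
  ΣB    = ∑ (λ w → [ B w ]· x u w) vs
  total = ∑ cost vs

  near-total : x u z ≤ 1ℚ - h → ΣB < h * #B → h * #P ≤ total
  near-total near ΣB<h#B = begin
    h * #P                          ≡⟨ sym (add-sub (h * #P) (h * #B)) ⟩
    (h * #P + h * #B) - h * #B      ≤⟨ +-monoˡ-≤ (- (h * #B)) summed ⟩
    (total + ΣB) - h * #B           <⟨ ℚP.+-monoˡ-< (- (h * #B)) (ℚP.+-monoʳ-< total ΣB<h#B) ⟩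
    (total + h * #B) - h * #B       ≡⟨ add-sub total (h * #B) ⟩
    total                           ∎
    where
    add-sub : ∀ p q → (p + q) - q ≡ p
    add-sub = solve-∀ ℚ-ring
    summed : h * #P + h * #B ≤ total + ΣB
    summed = begin
      h * #P + h * #B
        ≡⟨ sym (cong₂ _+_ (∑-*ˡ h _ vs) (∑-*ˡ h _ vs)) ⟩
      ∑ (λ w → h * [ P w ]· 1ℚ) vs + ∑ (λ w → h * [ B w ]· 1ℚ) vs
        ≡⟨ sym (∑-+ _ _ vs) ⟩
      ∑ (λ w → h * [ P w ]· 1ℚ + h * [ B w ]· 1ℚ) vs
        ≤⟨ ∑-mono-≤ (near-pointwise near) vs ⟩
      ∑ (λ w → cost w + [ B w ]· x u w) vs
        ≡⟨ ∑-+ cost _ vs ⟩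
      total + ΣB
        ∎

  far-total : 1ℚ - h < x u z → k * #P ≤ total
  far-total far = begin
    k * #P                      ≡⟨ sym (∑-*ˡ k _ vs) ⟩
    ∑ (λ w → k * [ P w ]· 1ℚ) vs ≤⟨ ∑-mono-≤ (far-pointwise far) vs ⟩
    total                       ∎

  M : ℚ
  M = recip k ⊔ ((+ 2) / 1 * recip α)

  0<k : 0ℚ < k
  0<k = begin-strict
    0ℚ                    <⟨ ℚP.+-mono-< (p<q⇒0<q-p α<½) (p<q⇒0<q-p α<½) ⟩
    (½ - α) + (½ - α)     ≡⟨ twice α ⟩
    k                     ∎
    where
    twice : ∀ a → (½ - a) + (½ - a) ≡ 1ℚ - (+ 2) / 1 * a
    twice = solve-∀ ℚ-ring

  total-nonNeg : 0ℚ ≤ total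
  total-nonNeg = ∑-nonNeg cost-nonNeg vs

  ≤-M*total : ∀ {c} → c ≤ M → #P ≤ c * total → #P ≤ M * total
  ≤-M*total c≤M #P≤c·total =
    ℚP.≤-trans #P≤c·total (ℚP.*-monoʳ-≤-nonNeg total {{nonNegative total-nonNeg}} c≤M)

  total-bound : ΣB < h * #B → #P ≤ M * total
  total-bound ΣB<h#B with x u z ℚP.≤? 1ℚ - h
  ... | yes near = ≤-M*total (ℚP.p≤q⊔p (recip k) _)
    (≤-by-inverse h h·2/α≡1 0≤2/α (near-total near ΣB<h#B))
    where
    h·2/α≡1 : h * ((+ 2) / 1 * recip α) ≡ 1ℚ
    h·2/α≡1 = trans (regroup α (recip α)) (recip-inverseʳ 0<α)
      where
      regroup : ∀ a r → a * ½ * ((+ 2) / 1 * r) ≡ a * r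
      regroup = solve-∀ ℚ-ring
    0≤2/α : 0ℚ ≤ (+ 2) / 1 * recip α
    0≤2/α = ℚP.*-monoˡ-≤-nonNeg ((+ 2) / 1) (recip-nonNeg 0<α)
  ... | no ¬near = ≤-M*total (ℚP.p≤p⊔q (recip k) _)
    (≤-by-inverse k (recip-inverseʳ 0<k) (recip-nonNeg 0<k) (far-total (ℚP.≰⇒> ¬near)))

  charging-bound : sumOver B (x u) < α * ℕtoℚ (card B) * ½ →
                   ℕtoℚ (card P) ≤ M * (sumOver P (λ w → x w z) + sumOver Q (λ w → 1ℚ - x w z))
  charging-bound below =
    subst₂ (λ c t → c ≤ M * t) (sym (card≡∑ P)) (sym sumOver≡total) (total-bound ΣB<h#B)
    where
    ΣB<h#B : ΣB < h * #B
    ΣB<h#B = subst₂ _<_ (sumOver≡∑ B (x u))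
                        (trans (cong (λ c → α * c * ½) (card≡∑ B)) (regroup α #B)) below
      where
      regroup : ∀ a c → a * c * ½ ≡ a * ½ * c
      regroup = solve-∀ ℚ-ring
    sumOver≡total : sumOver P (λ w → x w z) + sumOver Q (λ w → 1ℚ - x w z) ≡ total
    sumOver≡total = trans (cong₂ _+_ (sumOver≡∑ P (λ w → x w z)) (sumOver≡∑ Q (λ w → 1ℚ - x w z)))
                          (sym (∑-+ _ _ vs))

split-∧ : ∀ t p → DisjointUnion t (t ∧ p) (t ∧ not p)
split-∧ false _     = neither
split-∧ true  true  = left
split-∧ true  false = right

module AlgBProperties {n : ℕ} (G : LCBGraph n) (x : Fin n → Fin n → ℚ) (α γ : ℚ) where
  open LCBGraph G using (side; plus)
  open AlgB G x α γ

  V₁≢V₂ : ∀ {u w} → side u ≡ true → side w ≡ false → u ≢ w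
  V₁≢V₂ u∈V₁ w∈V₂ refl with trans (sym u∈V₁) w∈V₂
  ... | ()

  C≡T : ∀ S {u w} → u ≢ w → C S u w ≡ T S u w
  C≡T S {u} {w} u≢w with u ≟ w
  ... | yes u≡w = contradiction u≡w u≢w
  ... | no _    = refl

  T⇒≤α : ∀ S {u w} → T S u w ≡ true → x u w ≤ α
  T⇒≤α S {u} {w} w∈T =
    ℚP.≤ᵇ⇒≤ (Equivalence.from T-≡ (∧-conicalʳ _ _ (∧-conicalʳ (S w) _ w∈T)))

  ∉C⇒α< : ∀ S {u z} → S z ≡ true → C S u z ≡ false → α < x u z
  ∉C⇒α< S {u} {z} z∈S z∉C with u ≟ z | z∉C
  ... | yes refl | ()
  ... | no _     | z∉T rewrite z∈S =
    ℚP.≰⇒> (λ xuz≤α → subst Bool.T z∉T (ℚP.≤⇒≤ᵇ xuz≤α))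

  V₂∩T-split : ∀ S {u z} → side u ≡ true → side z ≡ true → ∀ w →
               DisjointUnion ((V₂ G ∩ T S u) w) ((C S u ∩ N⁺ G z) w) ((C S u ∩ N⁻ G z) w)
  V₂∩T-split S {u} {z} u∈V₁ z∈V₁ w with side w in w-side
  ... | true rewrite z∈V₁ | ∧-zeroʳ (C S u w) = neither
  ... | false rewrite z∈V₁ | C≡T S (V₁≢V₂ u∈V₁ w-side) = split-∧ (T S u w) (plus z w)

lemma6 : {n : ℕ} (G : LCBGraph n) (x : Fin n → Fin n → ℚ) → FracClustering n x →
         (α γ : ℚ) → 0ℚ < γ → γ < α → α < (+ 1) / 2 →
         (S : VSet n) → AlgB.Reachable G x α γ S →
         (u : Fin n) → AlgB.Pivot G x α γ S u →
         AlgB.sumV₂T G x α γ S u < AlgB.threshold G x α γ S u →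
         (z : Fin n) → V₁ G z ≡ true → S z ≡ true → AlgB.C G x α γ S u z ≡ false →
         ℕtoℚ (card (AlgB._∩_ G x α γ (AlgB.C G x α γ S u) (N⁺ G z)))
           ≤ (recip (1ℚ - (+ 2) / 1 * α) ⊔ ((+ 2) / 1 * recip α))
             * (sumOver (AlgB._∩_ G x α γ (AlgB.C G x α γ S u) (N⁺ G z)) (λ w → x w z)
                + sumOver (AlgB._∩_ G x α γ (AlgB.C G x α γ S u) (N⁻ G z)) (λ w → 1ℚ - x w z))
lemma6 G x fc α γ 0<γ γ<α α<½ S _ u pivot below z z∈V₁ z∈S z∉C =
  Charging.charging-bound fc (ℚP.<-trans 0<γ γ<α) α<½ (∉C⇒α< S z∈S z∉C)
    (V₂ G ∩ T S u) (C S u ∩ N⁺ G z) (C S u ∩ N⁻ G z)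
    (V₂∩T-split S (Pivot.inV₁ pivot) z∈V₁) (λ w → T⇒≤α S ∘ ∧-conicalʳ (V₂ G w) _)
    below
  where
  open AlgB G x α γ
  open AlgBProperties G x α γ
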